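{- For every rule set $\mathcal{R}$: if the TGD set $\mathsf{St}(\mathcal{R})$ is MFA, then $\mathcal{R}$ is EMFA.
   Context: Signature: finite sets of constants, function symbols, variables and predicates, predicates including binary equality $\approx$. Terms are built from constants and variables with function symbols; depth: $\mathrm{dep}(t)=1$ for constants/variables, $\mathrm{dep}(f(t_1,\dots,t_n))=\max_i\mathrm{dep}(t_i)+1$. A rule is a function- and constant-free formula, either a TGD $\forall\vec x\forall\vec y(\beta[\vec x,\vec y]\to\exists\vec w\,\eta[\vec x,\vec w])$ or an EGD $\forall\vec x(\beta[\vec x]\to x\approx y)$, where $\vec x,\vec y,\vec w$ are pairwise disjoint variable lists, $\vec x$ non-empty, $\beta,\eta$ non-empty conjunctions (treated as sets) of atoms not using $\approx$, $\varphi[\vec z]$ means $\vec z$ is exactly the free variables of $\varphi$, and $x,y\in\vec x$. A rule set is a finite set of rules in which no existentially quantified variable occurs in two different rules; a TGD set is a rule set with no EGDs. For a TGD, $\mathsf{Sk}(\eta)$ replaces each $w\in\vec w$ by $f_w(\vec x)$ with $f_w$ a fresh function symbol of arity $|\vec x|$ unique to $w$; for a substitution $\sigma$ (map from variables to ground terms), $\mathsf{Sk}_\sigma(\eta)$ replaces every syntactic occurrence of each variable $z$ in $\mathsf{Sk}(\eta)$ by $\sigma(z)$, and $\beta\sigma$ replaces each variable argument $z$ by $\sigma(z)$. For an atom set $\mathcal{M}$ and ground terms $t,u$, $\mathcal{M}[t/u]$ replaces every occurrence of $t$ directly as a predicate argument by $u$ (nested occurrences are not replaced). EMFA: the critical instance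 $\mathsf{CI}(\mathcal{R})$ is the set of all facts built from the predicates occurring in $\mathcal{R}$ and a special constant $\star$. $\mathsf{M}(\mathcal{R})$ is the minimal atom set such that: $\mathsf{CI}(\mathcal{R})\subseteq\mathsf{M}(\mathcal{R})$; for every TGD $\beta\to\exists\vec w.\eta\in\mathcal{R}$ and substitution $\sigma$ with $\beta\sigma\subseteq\mathsf{M}(\mathcal{R})$, $\mathsf{Sk}_\sigma(\eta)\subseteq\mathsf{M}(\mathcal{R})$; for every EGD $\beta\to x\approx y\in\mathcal{R}$ and substitution $\sigma$ with $\beta\sigma\subseteq\mathsf{M}(\mathcal{R})$, $\mathsf{M}(\mathcal{R})[\sigma(y)/\sigma(x)]\subseteq\mathsf{M}(\mathcal{R})$ if $\mathrm{dep}(\sigma(x))\le\mathrm{dep}(\sigma(y))$ and $\mathsf{M}(\mathcal{R})[\sigma(x)/\sigma(y)]\subseteq\mathsf{M}(\mathcal{R})$ if $\mathrm{dep}(\sigma(y))\le\mathrm{dep}(\sigma(x))$. A term is cyclic if it is of the form $f(\vec u)$ with $f$ occurring in some term of $\vec u$. $\mathcal{R}$ is EMFA if $\mathsf{M}(\mathcal{R})$ contains no cyclic terms; a TGD set is MFA if it is EMFA. Standard axiomatisation: let $\mathrm{Eq}$ be a fresh binary predicate. $\mathsf{St}(\mathcal{R})$ is the TGD set containing all TGDs of $\mathcal{R}$; the TGD $\beta\to\mathrm{Eq}(x,y)$ for every EGD $\beta\to x\approx y$ in $\mathcal{R}$; for every predicate $P\neq\approx$ occurring in $\mathcal{R}$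 of arity $n$, the rule $P(x_1,\dots,x_n)\to\bigwedge_{i=1}^n\mathrm{Eq}(x_i,x_i)$; the rules $\mathrm{Eq}(x,y)\to\mathrm{Eq}(y,x)$ and $\mathrm{Eq}(x,y)\wedge\mathrm{Eq}(y,z)\to\mathrm{Eq}(x,z)$; and for every such $P$ and $i\in\{1,\dots,n\}$ the rule $P(x_1,\dots,x_n)\wedge\mathrm{Eq}(x_i,x_i')\to P(x_1,\dots,x_{i-1},x_i',x_{i+1},\dots,x_n)$. -}

module Defs where

open import Data.Nat using (ℕ; zero; suc; _≤_; _⊔_; _≡ᵇ_)
open import Data.Bool using (Bool; true; false; if_then_else_; _∨_)
open import Data.Fin using (Fin; toℕ)
open import Data.List using (List; []; _∷_; _++_; map; concatMap; allFin)
open import Data.List.Membership.Propositional using (_∈_; _∉_)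
open import Data.List.Relation.Unary.Unique.Propositional using (Unique)
open import Data.Vec using (Vec; replicate; tabulate; toList; _[_]≔_)
  renaming (map to vmap; _∷_ to _∷ᵥ_; [] to []ᵥ)
import Data.Vec.Membership.Propositional as VM
open import Data.Vec.Relation.Binary.Pointwise.Inductive using (Pointwise)
open import Data.Sum using (_⊎_; inj₁; inj₂)
open import Data.Unit using (⊤; tt)
open import Data.Product using (_×_; Σ; _,_)
open import Relation.Binary.PropositionalEquality using (_≡_; _≢_)
open import Relation.Nullary using (¬_)

-- Variables are natural numbers; the only constant that
-- matters is the special constant ⋆ (rules are constant-free).  The
-- Skolem function symbol f_w is identified with the existential
-- variable w (unique to w because of the rule-set condition).

record Sig : Set₁ where
  field
    Pred  : Set
    arity : Pred → ℕ
open Sig public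

Var : Set
Var = ℕ

-- Atoms over a term type T (never using ≈; equality only occurs as EGD heads)
data Atom (S : Sig) (T : Set) : Set where
  atom : (p : Pred S) → Vec T (arity S p) → Atom S T

predOf : ∀ {S T} → Atom S T → Pred S
predOf (atom p _) = p

argsList : ∀ {S T} → Atom S T → List T
argsList (atom _ as) = toList as

data GTerm : Set where
  ⋆  : GTerm
  fn : Var → List GTerm → GTerm

mutual
  dep : GTerm → ℕ
  dep ⋆ = 1
  dep (fn _ ts) = suc (depL ts)

  depL : List GTerm → ℕ
  depL [] = 0
  depL (t ∷ ts) = dep t ⊔ depL ts

data _occursIn_ (f : Var) : GTerm → Set where
  here  : ∀ {ts} → f occursIn fn f ts
  there : ∀ {g u ts} → u ∈ ts → f occursIn u → f occursIn fn g ts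

data Cyclic : GTerm → Set where
  cyc : ∀ {f us u} → u ∈ us → f occursIn u → Cyclic (fn f us)

data _⊑_ (t : GTerm) : GTerm → Set where
  refl⊑ : t ⊑ t
  sub   : ∀ {g u ts} → t ⊑ u → u ∈ ts → t ⊑ fn g ts

data Rule (S : Sig) : Set where
  -- tgd β x⃗ w⃗ η  :  ∀x⃗∀y⃗ (β → ∃w⃗ η), with x⃗ the frontier list (its order
  -- fixes the argument order of Skolem terms)
  tgd : (body : List (Atom S Var)) (xs ws : List Var) (head : List (Atom S Var)) → Rule S
  egd : (body : List (Atom S Var)) (x y : Var) → Rule S

RuleSet : Sig → Set
RuleSet S = List (Rule S)

varsL : ∀ {S} → List (Atom S Var) → List Var
varsL = concatMap argsList

varsR : ∀ {S} → Rule S → List Var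
varsR (tgd b xs ws h) = varsL b ++ varsL h
varsR (egd b x y) = varsL b

existR : ∀ {S} → Rule S → List Var
existR (tgd _ _ ws _) = ws
existR (egd _ _ _) = []

Disjoint : List Var → List Var → Set
Disjoint a b = ∀ {z} → z ∈ a → z ∉ b

WFRule : ∀ {S} → Rule S → Set
WFRule (tgd b xs ws h) =
  b ≢ [] × h ≢ [] × xs ≢ [] × Unique xs × Unique ws
  × (∀ {z} → z ∈ xs → z ∈ varsL b)
  × Disjoint ws (varsL b)
  × (∀ {z} → z ∈ varsL h → z ∈ xs ⊎ z ∈ ws)
  × (∀ {z} → z ∈ xs → z ∈ varsL h)
  × (∀ {z} → z ∈ ws → z ∈ varsL h)
WFRule (egd b x y) = b ≢ [] × x ∈ varsL b × y ∈ varsL b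

RuleSetWF : ∀ {S} → RuleSet S → Set
RuleSetWF R =
  (∀ {r} → r ∈ R → WFRule r)
  × (∀ {r r' w} → r ∈ R → r' ∈ R → w ∈ existR r → w ∈ varsR r' → r ≡ r')

IsTGDSet : ∀ {S} → RuleSet S → Set
IsTGDSet R = ∀ {r} → r ∈ R → Σ _ λ b → Σ _ λ xs → Σ _ λ ws → Σ _ λ h → r ≡ tgd b xs ws h

predsR : ∀ {S} → Rule S → List (Pred S)
predsR (tgd b _ _ h) = map predOf b ++ map predOf h
predsR (egd b _ _) = map predOf b

preds : ∀ {S} → RuleSet S → List (Pred S)
preds = concatMap predsR

GAtom : Sig → Set
GAtom S = Atom S GTerm

inst : ∀ {S} → (Var → GTerm) → Atom S Var → GAtom S
inst σ (atom p as) = atom p (vmap σ as)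

elemᵇ : Var → List Var → Bool
elemᵇ z [] = false
elemᵇ z (v ∷ vs) = (z ≡ᵇ v) ∨ elemᵇ z vs

skArg : List Var → List Var → (Var → GTerm) → Var → GTerm
skArg xs ws σ z = if elemᵇ z ws then fn z (map σ xs) else σ z

sk : ∀ {S} → (Var → GTerm) → List Var → List Var → Atom S Var → GAtom S
sk σ xs ws (atom p as) = atom p (vmap (skArg xs ws σ) as)

-- replacing t by u in argument positions (not nested)
data Repl (t u : GTerm) : GTerm → GTerm → Set where
  hit  : Repl t u t u
  miss : ∀ {a} → a ≢ t → Repl t u a a

data ReplA {S} (t u : GTerm) : GAtom S → GAtom S → Set where
  mk : ∀ {p as bs} → Pointwise (Repl t u) as bs → ReplA t u (atom p as) (atom p bs)

data M {S : Sig} (R : RuleSet S) : GAtom S → Set where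
  ci   : ∀ {p} → p ∈ preds R → M R (atom p (replicate _ ⋆))
  tgdM : ∀ {b xs ws h} (σ : Var → GTerm) → tgd b xs ws h ∈ R
       → (∀ {B} → B ∈ b → M R (inst σ B))
       → ∀ {H} → H ∈ h → M R (sk σ xs ws H)
  egdL : ∀ {b x y} (σ : Var → GTerm) → egd b x y ∈ R
       → (∀ {B} → B ∈ b → M R (inst σ B))
       → dep (σ x) ≤ dep (σ y)
       → ∀ {A A'} → M R A → ReplA (σ y) (σ x) A A' → M R A'
  egdR : ∀ {b x y} (σ : Var → GTerm) → egd b x y ∈ R
       → (∀ {B} → B ∈ b → M R (inst σ B))
       → dep (σ y) ≤ dep (σ x)
       → ∀ {A A'} → M R A → ReplA (σ x) (σ y) A A' → M R A'

EMFA : ∀ {S} → RuleSet S → Set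
EMFA R = ∀ {A} → M R A → ∀ {a t} → a ∈ argsList A → t ⊑ a → ¬ Cyclic t

-- a TGD set is MFA iff it is EMFA
MFA : ∀ {S} → RuleSet S → Set
MFA R = IsTGDSet R × EMFA R

StSig : Sig → Sig
StSig S = record { Pred = Pred S ⊎ ⊤ ; arity = ar }
  where
  ar : Pred S ⊎ ⊤ → ℕ
  ar (inj₁ p) = arity S p
  ar (inj₂ _) = 2

module _ {S : Sig} where
  liftA : Atom S Var → Atom (StSig S) Var
  liftA (atom p as) = atom (inj₁ p) as

  EqA : Var → Var → Atom (StSig S) Var
  EqA x y = atom (inj₂ tt) (x ∷ᵥ y ∷ᵥ []ᵥ)

  stRule : Rule S → Rule (StSig S)
  stRule (tgd b xs ws h) = tgd (map liftA b) xs ws (map liftA h)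
  stRule (egd b x y) = tgd (map liftA b) (x ∷ y ∷ []) [] (EqA x y ∷ [])

  symRule : Rule (StSig S)
  symRule = tgd (EqA 0 1 ∷ []) (0 ∷ 1 ∷ []) [] (EqA 1 0 ∷ [])

  transRule : Rule (StSig S)
  transRule = tgd (EqA 0 1 ∷ EqA 1 2 ∷ []) (0 ∷ 2 ∷ []) [] (EqA 0 2 ∷ [])

  -- x₁,…,xₙ are the variables 0,…,n-1; xᵢ' is the variable n
  xsOf : (p : Pred S) → Vec Var (arity S p)
  xsOf p = tabulate toℕ

  reflRule : Pred S → Rule (StSig S)
  reflRule p = tgd (atom (inj₁ p) (xsOf p) ∷ []) (toList (xsOf p)) []
                   (map (λ x → EqA x x) (toList (xsOf p)))

  congRule : (p : Pred S) → Fin (arity S p) → Rule (StSig S)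
  congRule p i =
    tgd (atom (inj₁ p) (xsOf p) ∷ EqA (toℕ i) (arity S p) ∷ [])
        (toList (xsOf p [ i ]≔ arity S p)) []
        (atom (inj₁ p) (xsOf p [ i ]≔ arity S p) ∷ [])

  St : RuleSet S → RuleSet (StSig S)
  St R = map stRule R ++ symRule ∷ transRule
         ∷ concatMap (λ p → reflRule p ∷ map (congRule p) (allFin (arity S p))) (preds R)

{-# OPTIONS --safe #-}
module Submission where

-- The standard axiomatisation simulates the chase of R: every atom of M(R)
-- has its copy in M(St(R)) with the same arguments. TGD applications are
-- mirrored by the same TGDs, an EGD application with substitution σ first
-- derives Eq(σ(x), σ(y)) and then performs the replacement one argument
-- position at a time with the congruence rules (using symmetry for the
-- replacement in the other direction). Hence a cyclic term in M(R) would be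
-- one in M(St(R)).

open import Defs
open import Data.Nat using (ℕ; zero; suc)
open import Data.Fin using (Fin; toℕ) renaming (zero to fzero; suc to fsuc)
open import Data.List using (List; []; _∷_; map; concatMap; allFin)
open import Data.List.Membership.Propositional using (_∈_; find)
open import Data.List.Membership.Propositional.Properties
  using (∈-map⁺; ∈-map⁻; ∈-++⁺ˡ; ∈-++⁺ʳ; ∈-++⁻; ∈-allFin; ∈-concatMap⁺; ∈-concatMap⁻)
open import Data.List.Relation.Unary.Any using (here; there)
import Data.List.Relation.Unary.Any as Any
open import Data.Vec using (Vec; lookup; tabulate; _[_]≔_) renaming (map to vmap; _∷_ to _∷ᵥ_; [] to []ᵥ)
open import Data.Vec.Properties using (map-[]≔; tabulate∘lookup; tabulate-cong; tabulate-∘)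
open import Data.Vec.Relation.Binary.Pointwise.Inductive using (Pointwise; []; _∷_)
open import Function using (_∘_)
open import Data.Sum using (inj₁; inj₂)
open import Data.Unit using (tt)
open import Data.Product using (_,_)
open import Relation.Binary.PropositionalEquality using (_≡_; refl; sym; cong; cong₂; subst; module ≡-Reasoning)

∈-concatMap⁺′ : ∀ {A B : Set} (f : A → List B) {y : B} {x : A} {xs : List A}
  → y ∈ f x → x ∈ xs → y ∈ concatMap f xs
∈-concatMap⁺′ f y∈fx x∈xs = ∈-concatMap⁺ f (Any.map (λ { refl → y∈fx }) x∈xs)

module _ {A : Set} where

  lookupOr : ∀ {n} → Vec A n → A → ℕ → A
  lookupOr []ᵥ       d _       = d
  lookupOr (c ∷ᵥ cs) d zero    = c
  lookupOr (c ∷ᵥ cs) d (suc m) = lookupOr cs d m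

  lookupOr-toℕ : ∀ {n} (cs : Vec A n) d (i : Fin n) → lookupOr cs d (toℕ i) ≡ lookup cs i
  lookupOr-toℕ (c ∷ᵥ cs) d fzero    = refl
  lookupOr-toℕ (c ∷ᵥ cs) d (fsuc i) = lookupOr-toℕ cs d i

  lookupOr-length : ∀ {n} (cs : Vec A n) d → lookupOr cs d n ≡ d
  lookupOr-length []ᵥ       d = refl
  lookupOr-length (c ∷ᵥ cs) d = lookupOr-length cs d

  map-lookupOr-tabulate-toℕ : ∀ {n} (cs : Vec A n) d → vmap (lookupOr cs d) (tabulate toℕ) ≡ cs
  map-lookupOr-tabulate-toℕ cs d = begin
    vmap (lookupOr cs d) (tabulate toℕ) ≡⟨ tabulate-∘ (lookupOr cs d) toℕ ⟨
    tabulate (lookupOr cs d ∘ toℕ)      ≡⟨ tabulate-cong (lookupOr-toℕ cs d) ⟩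
    tabulate (lookup cs)                ≡⟨ tabulate∘lookup cs ⟩
    cs                                  ∎
    where open ≡-Reasoning

Pointwise-Repl-preserves : ∀ {t u k} (P : Vec GTerm k → Set)
  → (∀ cs i → lookup cs i ≡ t → P cs → P (cs [ i ]≔ u))
  → ∀ {as bs} → Pointwise (Repl t u) as bs → P as → P bs
Pointwise-Repl-preserves P step [] pas = pas
Pointwise-Repl-preserves {u = u} P step {a ∷ᵥ as} (hit ∷ rs) pas =
  Pointwise-Repl-preserves (λ v → P (u ∷ᵥ v)) (λ cs i → step (u ∷ᵥ cs) (fsuc i)) rs
    (step (a ∷ᵥ as) fzero refl pas)
Pointwise-Repl-preserves P step {a ∷ᵥ as} (miss _ ∷ rs) pas =
  Pointwise-Repl-preserves (λ v → P (a ∷ᵥ v)) (λ cs i → step (a ∷ᵥ cs) (fsuc i)) rs pas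

module _ {S : Sig} where

  liftG : GAtom S → GAtom (StSig S)
  liftG (atom p as) = atom (inj₁ p) as

  EqG : GTerm → GTerm → GAtom (StSig S)
  EqG a b = atom (inj₂ tt) (a ∷ᵥ b ∷ᵥ []ᵥ)

  predOf-liftA : (B : Atom S Var) → predOf (liftA B) ≡ inj₁ (predOf B)
  predOf-liftA (atom p as) = refl

  ∈-map-predOf-liftA : ∀ {p} (b : List (Atom S Var))
    → p ∈ map predOf b → inj₁ p ∈ map predOf (map liftA b)
  ∈-map-predOf-liftA b p∈ with ∈-map⁻ predOf p∈
  ... | B , B∈b , refl = subst (_∈ _) (predOf-liftA B) (∈-map⁺ predOf (∈-map⁺ liftA B∈b))

  ∈-predsR-stRule : ∀ {p} (r : Rule S) → p ∈ predsR r → inj₁ p ∈ predsR (stRule r)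
  ∈-predsR-stRule (tgd b xs ws h) p∈ with ∈-++⁻ (map predOf b) p∈
  ... | inj₁ p∈b = ∈-++⁺ˡ (∈-map-predOf-liftA b p∈b)
  ... | inj₂ p∈h = ∈-++⁺ʳ (map predOf (map liftA b)) (∈-map-predOf-liftA h p∈h)
  ∈-predsR-stRule (egd b x y) p∈ = ∈-++⁺ˡ (∈-map-predOf-liftA b p∈)

  liftG-inst : ∀ (P : GAtom (StSig S) → Set) σ (B : Atom S Var)
    → P (liftG (inst σ B)) → P (inst σ (liftA B))
  liftG-inst P σ (atom p as) PB = PB

  liftG-sk : ∀ (P : GAtom (StSig S) → Set) σ xs ws (H : Atom S Var)
    → P (sk σ xs ws (liftA H)) → P (liftG (sk σ xs ws H))
  liftG-sk P σ xs ws (atom p as) PH = PH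

module _ {S : Sig} (R : RuleSet S) where

  stRule∈St : ∀ {r} → r ∈ R → stRule r ∈ St R
  stRule∈St r∈R = ∈-++⁺ˡ (∈-map⁺ stRule r∈R)

  symRule∈St : symRule ∈ St R
  symRule∈St = ∈-++⁺ʳ (map stRule R) (here refl)

  congRule∈St : ∀ {p} → p ∈ preds R → (i : Fin (arity S p)) → congRule p i ∈ St R
  congRule∈St {p} p∈ i = ∈-++⁺ʳ (map stRule R) (there (there
    (∈-concatMap⁺′ (λ q → reflRule q ∷ map (congRule q) (allFin (arity S q)))
       (there (∈-map⁺ (congRule p) (∈-allFin i))) p∈)))

  inj₁-∈-preds-St : ∀ {p} → p ∈ preds R → inj₁ p ∈ preds (St R)
  inj₁-∈-preds-St p∈ with find (∈-concatMap⁻ predsR p∈)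
  ... | r , r∈R , p∈r = ∈-concatMap⁺′ predsR (∈-predsR-stRule r p∈r) (stRule∈St r∈R)

  predOf-M : ∀ {A} → M R A → predOf A ∈ preds R
  predOf-M (ci p∈) = p∈
  predOf-M (tgdM {b} σ r∈R _ {atom p as} H∈h) =
    ∈-concatMap⁺′ predsR (∈-++⁺ʳ (map predOf b) (∈-map⁺ predOf H∈h)) r∈R
  predOf-M (egdL _ _ _ _ m (mk _)) = predOf-M m
  predOf-M (egdR _ _ _ _ m (mk _)) = predOf-M m

  private
    MSt : GAtom (StSig S) → Set
    MSt = M (St R)

  Eq-sym : ∀ {a b} → MSt (EqG a b) → MSt (EqG b a)
  Eq-sym {a} {b} m = tgdM σ symRule∈St body (here refl)
    where
    σ : Var → GTerm
    σ zero    = a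
    σ (suc _) = b
    body : ∀ {B} → B ∈ EqA 0 1 ∷ [] → MSt (inst σ B)
    body (here refl) = m

  -- σ = lookupOr cs u sends the variables 0,…,n-1 (x₁,…,xₙ) to cs and n (xᵢ') to u.
  Eq-cong : ∀ {p u} → p ∈ preds R → (cs : Vec GTerm (arity S p)) (i : Fin (arity S p))
    → MSt (EqG (lookup cs i) u) → MSt (atom (inj₁ p) cs) → MSt (atom (inj₁ p) (cs [ i ]≔ u))
  Eq-cong {p} {u} p∈ cs i eq mcs = subst MSt head (tgdM σ (congRule∈St p∈ i) body (here refl))
    where
    n = arity S p
    σ = lookupOr cs u
    xs = xsOf {S} p
    body : ∀ {B} → B ∈ atom (inj₁ p) xs ∷ EqA {S} (toℕ i) n ∷ [] → MSt (inst σ B)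
    body (here refl) = subst MSt (cong (atom (inj₁ p)) (sym (map-lookupOr-tabulate-toℕ cs u))) mcs
    body (there (here refl)) =
      subst MSt (sym (cong₂ EqG (lookupOr-toℕ cs u i) (lookupOr-length cs u))) eq
    head : atom (inj₁ p) (vmap σ (xs [ i ]≔ n)) ≡ atom (inj₁ p) (cs [ i ]≔ u)
    head = cong (atom (inj₁ p)) (begin
      vmap σ (xs [ i ]≔ n)   ≡⟨ map-[]≔ σ xs i ⟩
      vmap σ xs [ i ]≔ σ n   ≡⟨ cong₂ (_[ i ]≔_) (map-lookupOr-tabulate-toℕ cs u) (lookupOr-length cs u) ⟩
      cs [ i ]≔ u            ∎)
      where open ≡-Reasoning

  liftG-Repl : ∀ {t u A A'} → M R A → MSt (EqG t u) → ReplA t u A A' → MSt (liftG A) → MSt (liftG A')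
  liftG-Repl {u = u} mA eq (mk {p} pw) =
    Pointwise-Repl-preserves (MSt ∘ atom (inj₁ p))
      (λ cs i cs[i]≡t → Eq-cong (predOf-M mA) cs i (subst (λ a → MSt (EqG a u)) (sym cs[i]≡t) eq))
      pw

  liftG-body : ∀ {b} σ → (∀ {B} → B ∈ b → MSt (liftG (inst σ B)))
    → ∀ {B'} → B' ∈ map liftA b → MSt (inst σ B')
  liftG-body σ mb B'∈ with ∈-map⁻ liftA B'∈
  ... | B , B∈b , refl = liftG-inst MSt σ B (mb B∈b)

  mutual
    liftG-M : ∀ {A} → M R A → MSt (liftG A)
    liftG-M (ci p∈) = ci (inj₁-∈-preds-St p∈)
    liftG-M (tgdM {xs = xs} {ws} σ r∈R mb {H} H∈h) =
      liftG-sk MSt σ xs ws H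
        (tgdM σ (stRule∈St r∈R) (liftG-body σ (λ B∈b → liftG-M (mb B∈b))) (∈-map⁺ liftA H∈h))
    liftG-M (egdL σ e∈R mb _ m rp) = liftG-Repl m (Eq-sym (Eq-egd σ e∈R mb)) rp (liftG-M m)
    liftG-M (egdR σ e∈R mb _ m rp) = liftG-Repl m (Eq-egd σ e∈R mb) rp (liftG-M m)

    Eq-egd : ∀ {b x y} σ → egd b x y ∈ R → (∀ {B} → B ∈ b → M R (inst σ B)) → MSt (EqG (σ x) (σ y))
    Eq-egd σ e∈R mb = tgdM σ (stRule∈St e∈R) (liftG-body σ (λ B∈b → liftG-M (mb B∈b))) (here refl)

theorem8 : ∀ {S : Sig} (R : RuleSet S) → RuleSetWF R → MFA (St R) → EMFA R
theorem8 R _ (_ , emfa-St) {atom p as} m = emfa-St (liftG-M R m)
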